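{- For every theory $T$ and all formulas $\phi,\psi$ of $L([1],[\omega],\mathtt u,\mathtt U)$: $T\vdash\phi\to\psi$ if and only if $T\cup\{\phi\}\vdash\psi$.
   Context: Let $Var=\{p_n : n\in\omega\}$. Formulas are built from $Var$ using unary $\lnot$, $[1]$, $[\omega]$ and binary $\land$, $\mathtt u$, $\mathtt U$; $\lor,\to,\leftrightarrow$ are defined as usual; $\mathtt f\phi:=(\phi\to\phi)\,\mathtt u\,\phi$, $\mathtt g\phi:=\lnot\mathtt f\lnot\phi$; $[a]^0\phi=\phi$, $[a]^{n+1}\phi=[a][a]^n\phi$ for $a\in\{1,\omega\}$. A theory is a nonempty set of formulas. Axioms are all instances of: A1 tautology instances; A2 $[1][\omega]\phi\leftrightarrow[\omega]\phi$; A3 $\lnot[a]\phi\leftrightarrow[a]\lnot\phi$, $a\in\{1,\omega\}$; A4 $[a](\phi*\psi)\leftrightarrow([a]\phi*[a]\psi)$ for $a\in\{1,\omega\}$, $*\in\{\land,\lor,\to,\leftrightarrow\}$; A5 $\psi\to(\phi\,\mathtt u\,\psi)$; A6 $\phi\,\mathtt u\,\psi\to\phi\,\mathtt U\,\psi$; A7 $\left(\bigwedge_{k=0}^n[1]^k(\phi\land\lnot\psi)\land[1]^{n+1}\psi\right)\to\phi\,\mathtt u\,\psi$; A8 $\left(\bigwedge_{k=0}^n[\omega]^k\mathtt g(\phi\land\lnot\psi)\land[\omega]^{n+1}(\phi\,\mathtt u\,\psi)\right)\to\phi\,\mathtt U\,\psi$ (for all $n\in\omega$). Rules: R1 modus ponens;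 R2 necessitation: from $\phi$ infer $[a]\phi$, $a\in\{1,\omega\}$; R3: from $\theta\to\lnot\psi$ and all $\theta\to\bigvee_{k=0}^n[1]^k(\lnot\phi\lor\psi)\lor[1]^{n+1}\lnot\psi$ ($n\in\omega$) infer $\theta\to\lnot(\phi\,\mathtt u\,\psi)$; R4: from $\theta\to\lnot(\phi\,\mathtt u\,\psi)$ and all $\theta\to\bigvee_{k=0}^n[\omega]^k\lnot\mathtt g(\phi\land\lnot\psi)\lor[\omega]^{n+1}\lnot(\phi\,\mathtt u\,\psi)$ ($n\in\omega$) infer $\theta\to\lnot(\phi\,\mathtt U\,\psi)$. A formula $\phi$ is a theorem ($\vdash\phi$) iff there is a sequence $\phi_0,\dots,\phi_\alpha$ of formulas of order type $\alpha+1$ for some countable ordinal $\alpha$, with $\phi_\alpha=\phi$, each member being an axiom or obtained from earlier members by a rule. $T\vdash\phi$ iff there is such a sequence ending in $\phi$ where each member is an axiom, an element of $T$, or obtained from earlier members by a rule, with necessitation applied only to theorems. -}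

module Defs where

open import Data.Nat using (ℕ; zero; suc)
open import Data.Bool using (Bool; true; false; not; _∧_)
open import Data.Product using (Σ; _×_; _,_)
open import Data.Sum using (_⊎_)
open import Relation.Binary.PropositionalEquality using (_≡_)

infixr 6 _∧'_
infixr 5 _∨'_
infixr 4 _⇒_
infix 3 _⇔'_

data Fm : Set where
  var  : ℕ → Fm
  ¬'   : Fm → Fm
  [1]  : Fm → Fm
  [ω]  : Fm → Fm
  _∧'_ : Fm → Fm → Fm
  _u_  : Fm → Fm → Fm
  _U_  : Fm → Fm → Fm

_∨'_ : Fm → Fm → Fm
φ ∨' ψ = ¬' (¬' φ ∧' ¬' ψ)

_⇒_ : Fm → Fm → Fm
φ ⇒ ψ = ¬' (φ ∧' ¬' ψ)

_⇔'_ : Fm → Fm → Fm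
φ ⇔' ψ = (φ ⇒ ψ) ∧' (ψ ⇒ φ)

f : Fm → Fm
f φ = (φ ⇒ φ) u φ

g : Fm → Fm
g φ = ¬' (f (¬' φ))

data Mod : Set where
  one omega : Mod

box : Mod → Fm → Fm
box one   = [1]
box omega = [ω]

iter : Mod → ℕ → Fm → Fm
iter a zero    φ = φ
iter a (suc n) φ = box a (iter a n φ)

bigAnd : ℕ → (ℕ → Fm) → Fm
bigAnd zero    F = F zero
bigAnd (suc n) F = bigAnd n F ∧' F (suc n)

bigOr : ℕ → (ℕ → Fm) → Fm
bigOr zero    F = F zero
bigOr (suc n) F = bigOr n F ∨' F (suc n)

data BinOp : Set where
  andO orO impO iffO : BinOp

app : BinOp → Fm → Fm → Fm
app andO = _∧'_
app orO  = _∨'_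
app impO = _⇒_
app iffO = _⇔'_

data PF : Set where
  pv  : ℕ → PF
  p¬  : PF → PF
  p∧  : PF → PF → PF

evalPF : (ℕ → Bool) → PF → Bool
evalPF v (pv n)    = v n
evalPF v (p¬ τ)    = not (evalPF v τ)
evalPF v (p∧ τ τ') = evalPF v τ ∧ evalPF v τ'

Tautology : PF → Set
Tautology τ = (v : ℕ → Bool) → evalPF v τ ≡ true

subst : (ℕ → Fm) → PF → Fm
subst σ (pv n)    = σ n
subst σ (p¬ τ)    = ¬' (subst σ τ)
subst σ (p∧ τ τ') = subst σ τ ∧' subst σ τ'

TautInstance : Fm → Set
TautInstance φ = Σ PF λ τ → Σ (ℕ → Fm) λ σ → Tautology τ × (subst σ τ ≡ φ)

data Axiom : Fm → Set where
  A1 : ∀ {φ} → TautInstance φ → Axiom φ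
  A2 : ∀ φ → Axiom ([1] ([ω] φ) ⇔' [ω] φ)
  A3 : ∀ a φ → Axiom (¬' (box a φ) ⇔' box a (¬' φ))
  A4 : ∀ a (o : BinOp) φ ψ → Axiom (box a (app o φ ψ) ⇔' app o (box a φ) (box a ψ))
  A5 : ∀ φ ψ → Axiom (ψ ⇒ (φ u ψ))
  A6 : ∀ φ ψ → Axiom ((φ u ψ) ⇒ (φ U ψ))
  A7 : ∀ φ ψ n →
       Axiom ((bigAnd n (λ k → iter one k (φ ∧' ¬' ψ)) ∧' iter one (suc n) ψ) ⇒ (φ u ψ))
  A8 : ∀ φ ψ n →
       Axiom ((bigAnd n (λ k → iter omega k (g (φ ∧' ¬' ψ))) ∧' iter omega (suc n) (φ u ψ)) ⇒ (φ U ψ))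

R3prem : Fm → Fm → Fm → ℕ → Fm
R3prem θ φ ψ n = θ ⇒ (bigOr n (λ k → iter one k (¬' φ ∨' ψ)) ∨' iter one (suc n) (¬' ψ))

R4prem : Fm → Fm → Fm → ℕ → Fm
R4prem θ φ ψ n = θ ⇒ (bigOr n (λ k → iter omega k (¬' (g (φ ∧' ¬' ψ)))) ∨' iter omega (suc n) (¬' (φ u ψ)))

-- Theorems: the least set containing the axioms and closed under R1–R4
-- (equivalently, formulas having a proof of countable ordinal length).
data Thm : Fm → Set where
  ax  : ∀ {φ} → Axiom φ → Thm φ
  mp  : ∀ {φ ψ} → Thm φ → Thm (φ ⇒ ψ) → Thm ψ
  nec : ∀ {φ} a → Thm φ → Thm (box a φ)
  r3  : ∀ {θ φ ψ} → Thm (θ ⇒ ¬' ψ) → ((n : ℕ) → Thm (R3prem θ φ ψ n)) →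
        Thm (θ ⇒ ¬' (φ u ψ))
  r4  : ∀ {θ φ ψ} → Thm (θ ⇒ ¬' (φ u ψ)) → ((n : ℕ) → Thm (R4prem θ φ ψ n)) →
        Thm (θ ⇒ ¬' (φ U ψ))

Theory : Set₁
Theory = Fm → Set

-- T ⊢ φ : necessitation only applied to theorems
data _⊢_ (T : Theory) : Fm → Set where
  ax  : ∀ {φ} → Axiom φ → T ⊢ φ
  hyp : ∀ {φ} → T φ → T ⊢ φ
  mp  : ∀ {φ ψ} → T ⊢ φ → T ⊢ (φ ⇒ ψ) → T ⊢ ψ
  nec : ∀ {φ} a → Thm φ → T ⊢ box a φ
  r3  : ∀ {θ φ ψ} → T ⊢ (θ ⇒ ¬' ψ) → ((n : ℕ) → T ⊢ R3prem θ φ ψ n) →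
        T ⊢ (θ ⇒ ¬' (φ u ψ))
  r4  : ∀ {θ φ ψ} → T ⊢ (θ ⇒ ¬' (φ u ψ)) → ((n : ℕ) → T ⊢ R4prem θ φ ψ n) →
        T ⊢ (θ ⇒ ¬' (φ U ψ))

_∪｛_｝ : Theory → Fm → Theory
(T ∪｛ φ ｝) χ = T χ ⊎ χ ≡ φ

NonEmpty : Theory → Set
NonEmpty T = Σ Fm T

-- Necessitation is harmless because it is only applied to theorems, which hold
-- without φ.  The infinitary rules R3 and R4 are harmless because their
-- conclusions have the form θ ⇒ χ for an arbitrary θ: the hypothesis φ is
-- absorbed by using φ ∧ θ in place of θ.
module Submission where

open import Defs
open import Function.Bundles using (_⇔_; mk⇔; Equivalence)
open import Data.Nat using (ℕ; zero; suc)
open import Data.Bool using (Bool; true; false; T; _∧_)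
open import Data.Bool.Properties using (T-∧; T-≡)
open import Data.Sum using (inj₁; inj₂)
open import Data.Product using (_,_; proj₁; proj₂)
open import Relation.Binary.PropositionalEquality using (_≡_; refl)
open Equivalence using (to)

all : (Bool → Bool) → Bool
all P = P true ∧ P false

all-sound : ∀ P → T (all P) → ∀ b → T (P b)
all-sound P h true  = proj₁ (to T-∧ h)
all-sound P h false = proj₂ (to T-∧ h)

⟨_,_,_⟩ : {A : Set} → A → A → A → ℕ → A
⟨ a , b , c ⟩ zero          = a
⟨ a , b , c ⟩ (suc zero)    = b
⟨ a , b , c ⟩ (suc (suc _)) = c

tautology₃? : PF → Bool
tautology₃? τ = all λ a → all λ b → all λ c → evalPF ⟨ a , b , c ⟩ τ

-- For τ built from pv 0, pv 1, pv 2 only, evalPF v τ is definitionally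
-- evalPF ⟨ v 0 , v 1 , v 2 ⟩ τ, so this yields Tautology τ by a truth table.
tautology₃?-sound : ∀ τ → T (tautology₃? τ) → ∀ a b c → evalPF ⟨ a , b , c ⟩ τ ≡ true
tautology₃?-sound τ h a b c =
  to T-≡ (all-sound (λ c → evalPF ⟨ a , b , c ⟩ τ)
            (all-sound (λ b → all λ c → evalPF ⟨ a , b , c ⟩ τ)
              (all-sound (λ a → all λ b → all λ c → evalPF ⟨ a , b , c ⟩ τ) h a) b) c)

infixr 4 _⇒ᵖ_

_⇒ᵖ_ : PF → PF → PF
τ ⇒ᵖ τ′ = p¬ (p∧ τ (p¬ τ′))

p₀ p₁ p₂ : PF
p₀ = pv 0
p₁ = pv 1
p₂ = pv 2

identity : PF
identity = p₀ ⇒ᵖ p₀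

weakening : PF
weakening = p₀ ⇒ᵖ p₁ ⇒ᵖ p₀

distribution : PF
distribution = (p₀ ⇒ᵖ p₁) ⇒ᵖ (p₀ ⇒ᵖ p₁ ⇒ᵖ p₂) ⇒ᵖ p₀ ⇒ᵖ p₂

importation : PF
importation = (p₀ ⇒ᵖ p₁ ⇒ᵖ p₂) ⇒ᵖ p∧ p₀ p₁ ⇒ᵖ p₂

exportation : PF
exportation = (p∧ p₀ p₁ ⇒ᵖ p₂) ⇒ᵖ p₀ ⇒ᵖ p₁ ⇒ᵖ p₂

identity-tautology : Tautology identity
identity-tautology v = tautology₃?-sound identity _ (v 0) (v 1) (v 2)

weakening-tautology : Tautology weakening
weakening-tautology v = tautology₃?-sound weakening _ (v 0) (v 1) (v 2)

distribution-tautology : Tautology distribution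
distribution-tautology v = tautology₃?-sound distribution _ (v 0) (v 1) (v 2)

importation-tautology : Tautology importation
importation-tautology v = tautology₃?-sound importation _ (v 0) (v 1) (v 2)

exportation-tautology : Tautology exportation
exportation-tautology v = tautology₃?-sound exportation _ (v 0) (v 1) (v 2)

⊢-tautology₃ : ∀ {Γ} τ → Tautology τ → ∀ A B C → Γ ⊢ subst ⟨ A , B , C ⟩ τ
⊢-tautology₃ τ taut A B C = ax (A1 (τ , ⟨ A , B , C ⟩ , taut , refl))

⊢-identity : ∀ {Γ} A → Γ ⊢ (A ⇒ A)
⊢-identity A = ⊢-tautology₃ identity identity-tautology A A A

⊢-weaken-antecedent : ∀ {Γ A B} → Γ ⊢ B → Γ ⊢ (A ⇒ B)
⊢-weaken-antecedent {A = A} {B} ⊢B =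
  mp ⊢B (⊢-tautology₃ weakening weakening-tautology B A A)

⊢-mp-under : ∀ {Γ A B C} → Γ ⊢ (A ⇒ B) → Γ ⊢ (A ⇒ (B ⇒ C)) → Γ ⊢ (A ⇒ C)
⊢-mp-under {A = A} {B} {C} ⊢A⇒B ⊢A⇒B⇒C =
  mp ⊢A⇒B⇒C (mp ⊢A⇒B (⊢-tautology₃ distribution distribution-tautology A B C))

⊢-import : ∀ {Γ A B C} → Γ ⊢ (A ⇒ (B ⇒ C)) → Γ ⊢ ((A ∧' B) ⇒ C)
⊢-import {A = A} {B} {C} ⊢A⇒B⇒C =
  mp ⊢A⇒B⇒C (⊢-tautology₃ importation importation-tautology A B C)

⊢-export : ∀ {Γ A B C} → Γ ⊢ ((A ∧' B) ⇒ C) → Γ ⊢ (A ⇒ (B ⇒ C))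
⊢-export {A = A} {B} {C} ⊢A∧B⇒C =
  mp ⊢A∧B⇒C (⊢-tautology₃ exportation exportation-tautology A B C)

⊢-mono : ∀ {Γ Δ χ} → (∀ {ψ} → Γ ψ → Δ ψ) → Γ ⊢ χ → Δ ⊢ χ
⊢-mono Γ⊆Δ (ax axiom)  = ax axiom
⊢-mono Γ⊆Δ (hyp γ)     = hyp (Γ⊆Δ γ)
⊢-mono Γ⊆Δ (mp d e)    = mp (⊢-mono Γ⊆Δ d) (⊢-mono Γ⊆Δ e)
⊢-mono Γ⊆Δ (nec a thm) = nec a thm
⊢-mono Γ⊆Δ (r3 d ds)   = r3 (⊢-mono Γ⊆Δ d) (λ n → ⊢-mono Γ⊆Δ (ds n))
⊢-mono Γ⊆Δ (r4 d ds)   = r4 (⊢-mono Γ⊆Δ d) (λ n → ⊢-mono Γ⊆Δ (ds n))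

deduction : ∀ {Γ φ ψ} → (Γ ∪｛ φ ｝) ⊢ ψ → Γ ⊢ (φ ⇒ ψ)
deduction (ax axiom)                = ⊢-weaken-antecedent (ax axiom)
deduction (hyp (inj₁ γ))            = ⊢-weaken-antecedent (hyp γ)
deduction {φ = φ} (hyp (inj₂ refl)) = ⊢-identity φ
deduction (mp d e)                  = ⊢-mp-under (deduction d) (deduction e)
deduction (nec a thm)               = ⊢-weaken-antecedent (nec a thm)
deduction (r3 d ds) =
  ⊢-export (r3 (⊢-import (deduction d)) (λ n → ⊢-import (deduction (ds n))))
deduction (r4 d ds) =
  ⊢-export (r4 (⊢-import (deduction d)) (λ n → ⊢-import (deduction (ds n))))

deduction⁻¹ : ∀ {Γ φ ψ} → Γ ⊢ (φ ⇒ ψ) → (Γ ∪｛ φ ｝) ⊢ ψ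
deduction⁻¹ ⊢φ⇒ψ = mp (hyp (inj₂ refl)) (⊢-mono inj₁ ⊢φ⇒ψ)

mainTheorem2 : (T : Theory) → NonEmpty T → (φ ψ : Fm) →
    (T ⊢ (φ ⇒ ψ)) ⇔ ((T ∪｛ φ ｝) ⊢ ψ)
mainTheorem2 T _ φ ψ = mk⇔ deduction⁻¹ deduction
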